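{- Let $G=(V,E)$ be the complete graph on $n$ vertices with a positive self-loop at every vertex, where every edge is labelled $+$ or $-$. Then the correlation metric $d$ satisfies the triangle inequality: \[ d_{uv}+d_{vw}\ge d_{uw}\quad\text{for all } u,v,w\in V. \]
   Context: $E^+$ and $E^-$ denote the sets of positive and negative edges, and every vertex $v$ has a positive self-loop $(v,v)\in E^+$. For $u\in V$, $N_u^+=\{v\in V:(u,v)\in E^+\}$ and $N_u^-=\{v\in V:(u,v)\in E^-\}$. The correlation metric is \[ d_{uv}=1-\frac{|N_u^+\cap N_v^+|}{n-|N_u^-\cap N_v^-|}, \qquad u,v\in V, \] where the denominator is positive by the self-loops. -}

module Defs where

open import Data.Bool using (Bool; true; false; not)
open import Data.Nat as ℕ using (ℕ; _∸_; _<_; NonZero)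
open import Data.Nat.Properties as ℕP using (m<n⇒0<n∸m)
open import Data.Fin using (Fin)
open import Data.Fin.Subset using (Subset; _∩_; ∣_∣; _∈_; _∉_; ⊤; _⊂_)
open import Data.Fin.Subset.Properties using (x∈p∩q⁻; p⊂q⇒∣p∣<∣q∣; ∣⊤∣≡n; ⊆⊤; ∈⊤)
open import Data.Vec using (tabulate)
open import Data.Vec.Properties using (lookup∘tabulate; []=⇒lookup)
import Data.Empty
open import Data.Product using (proj₁; _,_)
open import Data.Integer using (+_)
open import Data.Rational using (ℚ; _/_; 1ℚ; _-_)
open import Relation.Binary.PropositionalEquality using (_≡_; refl; sym; trans; subst)

-- A complete graph on the vertex set Fin n, with every edge (u,v) labelled
-- + (true) or - (false), symmetric, and a positive self-loop at every vertex.
record SignedCompleteGraph (n : ℕ) : Set where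
  field
    label    : Fin n → Fin n → Bool
    label-sym  : ∀ u v → label u v ≡ label v u
    loop-pos : ∀ v → label v v ≡ true
open SignedCompleteGraph public

module _ {n : ℕ} (G : SignedCompleteGraph n) where

  N⁺ : Fin n → Subset n
  N⁺ u = tabulate (λ v → label G u v)

  N⁻ : Fin n → Subset n
  N⁻ u = tabulate (λ v → not (label G u v))

  private
    u∉N⁻u : ∀ u → u ∉ N⁻ u
    u∉N⁻u u u∈ with trans (sym (lookup∘tabulate (λ v → not (label G u v)) u)) ([]=⇒lookup u∈)
    ... | eq rewrite loop-pos G u = notfalse eq
      where
      notfalse : false ≡ true → Data.Empty.⊥
      notfalse ()

  neg-common<n : ∀ u v → ∣ N⁻ u ∩ N⁻ v ∣ < n
  neg-common<n u v =
    subst (∣ N⁻ u ∩ N⁻ v ∣ <_) (∣⊤∣≡n n)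
      (p⊂q⇒∣p∣<∣q∣ (⊆⊤ , u , ∈⊤ , λ x → u∉N⁻u u (proj₁ (x∈p∩q⁻ (N⁻ u) (N⁻ v) x))))

  denom : Fin n → Fin n → ℕ
  denom u v = n ∸ ∣ N⁻ u ∩ N⁻ v ∣

  denom-nonZero : ∀ u v → NonZero (denom u v)
  denom-nonZero u v = ℕ.>-nonZero (m<n⇒0<n∸m (neg-common<n u v))

  d : Fin n → Fin n → ℚ
  d u v = 1ℚ - ((+ ∣ N⁺ u ∩ N⁺ v ∣) / denom u v) {{denom-nonZero u v}}

-- N⁻_u is the complement of N⁺_u, so the denominator n − |N⁻_u ∩ N⁻_v| is
-- |N⁺_u ∪ N⁺_v| and d is the Jaccard distance
-- |N⁺_u △ N⁺_v| / |N⁺_u ∪ N⁺_v| of positive neighbourhoods.  For sets A, B, C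
-- let b = |B ∖ (A ∪ C)|.  Adding b to numerator and denominator increases
-- |A △ C| / |A ∪ C|; the new numerator is at most |A △ B| + |B △ C| and the new
-- denominator is |A ∪ B ∪ C|, which dominates both |A ∪ B| and |B ∪ C|.
module Submission where

module Fractions where

  open import Data.Nat as ℕ using (ℕ; suc; NonZero; _*_)
  open import Data.Nat.Properties as ℕ using (*-monoˡ-≤; *-monoʳ-≤; *-distribˡ-+; *-distribʳ-+)
  open import Data.Integer as ℤ using (ℤ; +_)
  import Data.Integer.Properties as ℤ
  open import Data.Integer.Tactic.RingSolver using (solve-∀)
  open import Data.Rational using (_/_; 1ℚ; _-_; _+_; _≤_; toℚᵘ)
  open import Data.Rational.Properties
    using (toℚᵘ-fromℚᵘ; toℚᵘ-injective; toℚᵘ-cancel-≤; toℚᵘ-homo-+; +-0-abelianGroup; +-mono-≤; module ≤-Reasoning)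
  open import Data.Rational.Unnormalised as ℚᵘ using (mkℚᵘ; *≡*; *≤*; _≃_)
  open import Data.Rational.Unnormalised.Properties as ℚᵘ using (≃-sym; ≤-respˡ-≃; ≤-respʳ-≃)
  open import Algebra.Properties.AbelianGroup +-0-abelianGroup using (xyx⁻¹≈y)
  open import Relation.Binary.PropositionalEquality using (_≡_; refl; cong; sym; subst₂; module ≡-Reasoning)

  toℚᵘ-/ : ∀ m n .{{_ : NonZero n}} → toℚᵘ ((+ m) / n) ≃ (+ m) ℚᵘ./ n
  toℚᵘ-/ m (suc n) = toℚᵘ-fromℚᵘ (mkℚᵘ (+ m) n)

  *≤*⇒/≤/ : ∀ a b c d .{{_ : NonZero b}} .{{_ : NonZero d}} →
            a * d ℕ.≤ c * b → (+ a) / b ≤ (+ c) / d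
  *≤*⇒/≤/ a b@(suc _) c d@(suc _) ad≤cb =
    toℚᵘ-cancel-≤ (≤-respˡ-≃ (≃-sym (toℚᵘ-/ a b)) (≤-respʳ-≃ (≃-sym (toℚᵘ-/ c d))
      (*≤* (subst₂ ℤ._≤_ (ℤ.pos-* a d) (ℤ.pos-* c b) (ℤ.+≤+ ad≤cb)))))

  /ᵘ-distribʳ-+ : ∀ m k n .{{_ : NonZero n}} → (+ (m ℕ.+ k)) ℚᵘ./ n ≃ (+ m) ℚᵘ./ n ℚᵘ.+ (+ k) ℚᵘ./ n
  /ᵘ-distribʳ-+ m k (suc n) = *≡* (sym (cross (+ m) (+ k) (+ suc n)))
    where
    cross : ∀ (x y s : ℤ) → (x ℤ.* s ℤ.+ y ℤ.* s) ℤ.* s ≡ (x ℤ.+ y) ℤ.* (s ℤ.* s)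
    cross = solve-∀

  /-distribʳ-+ : ∀ m k n .{{_ : NonZero n}} → (+ (m ℕ.+ k)) / n ≡ (+ m) / n + (+ k) / n
  /-distribʳ-+ m k n = toℚᵘ-injective (begin-equality
    toℚᵘ ((+ (m ℕ.+ k)) / n)                 ≃⟨ toℚᵘ-/ (m ℕ.+ k) n ⟩
    (+ (m ℕ.+ k)) ℚᵘ./ n                     ≃⟨ /ᵘ-distribʳ-+ m k n ⟩
    (+ m) ℚᵘ./ n ℚᵘ.+ (+ k) ℚᵘ./ n           ≃⟨ ℚᵘ.+-cong (toℚᵘ-/ m n) (toℚᵘ-/ k n) ⟨
    toℚᵘ ((+ m) / n) ℚᵘ.+ toℚᵘ ((+ k) / n)   ≃⟨ toℚᵘ-homo-+ ((+ m) / n) ((+ k) / n) ⟨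
    toℚᵘ ((+ m) / n + (+ k) / n)             ∎)
    where open ℚᵘ.≤-Reasoning

  n/n≡1 : ∀ n .{{_ : NonZero n}} → (+ n) / n ≡ 1ℚ
  n/n≡1 n@(suc _) = toℚᵘ-injective (ℚᵘ.≃-trans (toℚᵘ-/ n n) (*≡* (ℤ.*-comm (+ n) (+ 1))))

  1-m/n≡k/n : ∀ m k {n} .{{_ : NonZero n}} → m ℕ.+ k ≡ n → 1ℚ - (+ m) / n ≡ (+ k) / n
  1-m/n≡k/n m k {n} refl = begin
    1ℚ - (+ m) / n                       ≡⟨ cong (_- (+ m) / n) (n/n≡1 n) ⟨
    (+ (m ℕ.+ k)) / n - (+ m) / n        ≡⟨ cong (_- (+ m) / n) (/-distribʳ-+ m k n) ⟩
    (+ m) / n + (+ k) / n - (+ m) / n    ≡⟨ xyx⁻¹≈y ((+ m) / n) ((+ k) / n) ⟩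
    (+ k) / n                            ∎
    where open ≡-Reasoning

  m/n≤[m+k]/[n+k] : ∀ {m n} k → m ℕ.≤ suc n → (+ m) / suc n ≤ (+ (m ℕ.+ k)) / suc (n ℕ.+ k)
  m/n≤[m+k]/[n+k] {m} {n} k m≤n = *≤*⇒/≤/ m (suc n) (m ℕ.+ k) (suc (n ℕ.+ k)) (begin
    m * (suc n ℕ.+ k)            ≡⟨ *-distribˡ-+ m (suc n) k ⟩
    m * suc n ℕ.+ m * k          ≤⟨ ℕ.+-monoʳ-≤ (m * suc n) (*-monoˡ-≤ k m≤n) ⟩
    m * suc n ℕ.+ suc n * k      ≡⟨ cong (m * suc n ℕ.+_) (ℕ.*-comm (suc n) k) ⟩
    m * suc n ℕ.+ k * suc n      ≡⟨ *-distribʳ-+ (suc n) m k ⟨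
    (m ℕ.+ k) * suc n            ∎)
    where open ℕ.≤-Reasoning

  jaccard-triangle : ∀ {D₁ D₂ D₃ U₁ U₂ U₃ b} .{{_ : NonZero U₁}} .{{_ : NonZero U₂}} .{{_ : NonZero U₃}} →
                     D₁ ℕ.≤ U₁ → D₁ ℕ.+ b ℕ.≤ D₂ ℕ.+ D₃ → U₂ ℕ.≤ U₁ ℕ.+ b → U₃ ℕ.≤ U₁ ℕ.+ b →
                     (+ D₁) / U₁ ≤ (+ D₂) / U₂ + (+ D₃) / U₃
  jaccard-triangle {D₁} {D₂} {D₃} {suc U} {U₂} {U₃} {b} D₁≤U₁ D₁+b≤D₂+D₃ U₂≤U₁+b U₃≤U₁+b = begin
    (+ D₁) / suc U                            ≤⟨ m/n≤[m+k]/[n+k] b D₁≤U₁ ⟩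
    (+ (D₁ ℕ.+ b)) / W                        ≤⟨ *≤*⇒/≤/ (D₁ ℕ.+ b) W (D₂ ℕ.+ D₃) W (*-monoˡ-≤ W D₁+b≤D₂+D₃) ⟩
    (+ (D₂ ℕ.+ D₃)) / W                       ≡⟨ /-distribʳ-+ D₂ D₃ W ⟩
    (+ D₂) / W + (+ D₃) / W                   ≤⟨ +-mono-≤ (*≤*⇒/≤/ D₂ W D₂ U₂ (*-monoʳ-≤ D₂ U₂≤U₁+b))
                                                          (*≤*⇒/≤/ D₃ W D₃ U₃ (*-monoʳ-≤ D₃ U₃≤U₁+b)) ⟩
    (+ D₂) / U₂ + (+ D₃) / U₃                 ∎
    where
    open ≤-Reasoning
    W : ℕ
    W = suc (U ℕ.+ b)

module Counting where

  open import Data.Bool using (Bool; true; false; not; _∧_; _∨_; _xor_)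
  open import Data.Nat using (ℕ; zero; suc; _+_; _≤_; z≤n; s≤s)
  open import Data.Nat.Properties
    using (+-0-commutativeMonoid; +-mono-≤; ≤-refl; ≤-trans; ≤-reflexive; module ≤-Reasoning)
  import Data.Fin as Fin
  open import Data.Fin.Subset using (∣_∣)
  open import Data.Vec as Vec using (tabulate)
  open import Data.Vec.Functional using (Vector)
  open import Algebra.Properties.CommutativeMonoid.Sum +-0-commutativeMonoid
    using (sum; ∑-distrib-+; sum-cong-≗)
  open import Relation.Binary.PropositionalEquality using (_≡_; refl; cong; sym; trans)

  𝟙 : Bool → ℕ
  𝟙 true  = 1
  𝟙 false = 0

  count : ∀ {n} → Vector Bool n → ℕ
  count p = sum (λ i → 𝟙 (p i))

  sum-mono-≤ : ∀ {n} {f g : Vector ℕ n} → (∀ i → f i ≤ g i) → sum f ≤ sum g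
  sum-mono-≤ {zero}  f≤g = z≤n
  sum-mono-≤ {suc n} f≤g = +-mono-≤ (f≤g Fin.zero) (sum-mono-≤ (λ i → f≤g (Fin.suc i)))

  ∣tabulate∣≡count : ∀ {n} (p : Vector Bool n) → ∣ tabulate p ∣ ≡ count p
  ∣tabulate∣≡count {zero}  p = refl
  ∣tabulate∣≡count {suc n} p with p Fin.zero
  ... | true  = cong suc (∣tabulate∣≡count (λ i → p (Fin.suc i)))
  ... | false = ∣tabulate∣≡count (λ i → p (Fin.suc i))

  zipWith-tabulate : ∀ {n} {A B C : Set} (f : A → B → C) (p : Vector A n) (q : Vector B n) →
                     Vec.zipWith f (tabulate p) (tabulate q) ≡ tabulate (λ i → f (p i) (q i))
  zipWith-tabulate {zero}  f p q = refl
  zipWith-tabulate {suc n} f p q =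
    cong (f (p Fin.zero) (q Fin.zero) Vec.∷_) (zipWith-tabulate f (λ i → p (Fin.suc i)) (λ i → q (Fin.suc i)))

  ∣zipWith-tabulate∣≡count : ∀ {n} (f : Bool → Bool → Bool) (p q : Vector Bool n) →
                             ∣ Vec.zipWith f (tabulate p) (tabulate q) ∣ ≡ count (λ i → f (p i) (q i))
  ∣zipWith-tabulate∣≡count f p q =
    trans (cong ∣_∣ (zipWith-tabulate f p q)) (∣tabulate∣≡count (λ i → f (p i) (q i)))

  count-∧+count-xor≡count-∨ : ∀ {n} (p q : Vector Bool n) →
                              count (λ i → p i ∧ q i) + count (λ i → p i xor q i) ≡ count (λ i → p i ∨ q i)
  count-∧+count-xor≡count-∨ {n} p q =
    trans (sym (∑-distrib-+ {n} _ _)) (sum-cong-≗ (λ i → table (p i) (q i)))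
    where
    table : ∀ x y → 𝟙 (x ∧ y) + 𝟙 (x xor y) ≡ 𝟙 (x ∨ y)
    table true  true  = refl
    table true  false = refl
    table false y     = refl

  count-xor≤count-∨ : ∀ {n} (p q : Vector Bool n) → count (λ i → p i xor q i) ≤ count (λ i → p i ∨ q i)
  count-xor≤count-∨ p q = sum-mono-≤ (λ i → table (p i) (q i))
    where
    table : ∀ x y → 𝟙 (x xor y) ≤ 𝟙 (x ∨ y)
    table true  true  = z≤n
    table true  false = ≤-refl
    table false y     = ≤-refl

  count-xor-triangle : ∀ {n} (p q r : Vector Bool n) →
                       count (λ i → p i xor r i) + count (λ i → q i ∧ not (p i ∨ r i))
                         ≤ count (λ i → p i xor q i) + count (λ i → q i xor r i)
  count-xor-triangle {n} p q r = begin
    count (λ i → p i xor r i) + count (λ i → q i ∧ not (p i ∨ r i)) ≡⟨ ∑-distrib-+ {n} _ _ ⟨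
    sum (λ i → 𝟙 (p i xor r i) + 𝟙 (q i ∧ not (p i ∨ r i)))           ≤⟨ sum-mono-≤ (λ i → table (p i) (q i) (r i)) ⟩
    sum (λ i → 𝟙 (p i xor q i) + 𝟙 (q i xor r i))                     ≡⟨ ∑-distrib-+ {n} _ _ ⟩
    count (λ i → p i xor q i) + count (λ i → q i xor r i)             ∎
    where
    open ≤-Reasoning
    table : ∀ x y z → 𝟙 (x xor z) + 𝟙 (y ∧ not (x ∨ z)) ≤ 𝟙 (x xor y) + 𝟙 (y xor z)
    table true  true  true  = z≤n
    table true  true  false = ≤-refl
    table true  false true  = z≤n
    table true  false false = ≤-refl
    table false true  true  = ≤-refl
    table false true  false = s≤s z≤n
    table false false true  = ≤-refl
    table false false false = z≤n

  count-∨ˡ-cover : ∀ {n} (p q r : Vector Bool n) →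
                   count (λ i → p i ∨ q i) ≤ count (λ i → p i ∨ r i) + count (λ i → q i ∧ not (p i ∨ r i))
  count-∨ˡ-cover {n} p q r =
    ≤-trans (sum-mono-≤ (λ i → table (p i) (q i) (r i))) (≤-reflexive (∑-distrib-+ {n} _ _))
    where
    table : ∀ x y z → 𝟙 (x ∨ y) ≤ 𝟙 (x ∨ z) + 𝟙 (y ∧ not (x ∨ z))
    table true  y     z     = s≤s z≤n
    table false true  true  = s≤s z≤n
    table false true  false = s≤s z≤n
    table false false z     = z≤n

  count-∨ʳ-cover : ∀ {n} (p q r : Vector Bool n) →
                   count (λ i → q i ∨ r i) ≤ count (λ i → p i ∨ r i) + count (λ i → q i ∧ not (p i ∨ r i))
  count-∨ʳ-cover {n} p q r =
    ≤-trans (sum-mono-≤ (λ i → table (p i) (q i) (r i))) (≤-reflexive (∑-distrib-+ {n} _ _))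
    where
    table : ∀ x y z → 𝟙 (y ∨ z) ≤ 𝟙 (x ∨ z) + 𝟙 (y ∧ not (x ∨ z))
    table true  true  z     = s≤s z≤n
    table true  false true  = s≤s z≤n
    table true  false false = z≤n
    table false true  true  = s≤s z≤n
    table false true  false = s≤s z≤n
    table false false true  = s≤s z≤n
    table false false false = z≤n

open import Defs
open import Data.Bool using (Bool; not; _∧_; _∨_; _xor_)
open import Data.Nat using (ℕ; NonZero; _∸_)
open import Data.Nat.Properties using (m∸[m∸n]≡n)
open import Data.Fin using (Fin)
open import Data.Fin.Subset using (_∩_; _∪_; ∁; ∣_∣)
open import Data.Fin.Subset.Properties using (∪-∩-booleanAlgebra; ∣∁p∣≡n∸∣p∣; ∣p∣≤n)
open import Data.Integer using (+_)
open import Data.Rational using (_/_; 1ℚ; _-_; _+_; _≤_)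
open import Data.Rational.Properties using (/-cong; module ≤-Reasoning)
open import Data.Vec.Properties using (tabulate-∘)
open import Relation.Binary.PropositionalEquality using (_≡_; cong; cong₂; subst; module ≡-Reasoning)
open Fractions using (jaccard-triangle; 1-m/n≡k/n)
open Counting

module _ {n : ℕ} (G : SignedCompleteGraph n) where

  open import Algebra.Lattice.Properties.BooleanAlgebra (∪-∩-booleanAlgebra n) using (deMorgan₂)

  ∣∪∣ ∣△∣ : Fin n → Fin n → ℕ
  ∣∪∣ u v = count (λ i → label G u i ∨ label G v i)
  ∣△∣ u v = count (λ i → label G u i xor label G v i)

  N⁻≡∁N⁺ : ∀ u → N⁻ G u ≡ ∁ (N⁺ G u)
  N⁻≡∁N⁺ u = tabulate-∘ not (label G u)

  denom≡∣∪∣ : ∀ u v → denom G u v ≡ ∣∪∣ u v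
  denom≡∣∪∣ u v = begin
    n ∸ ∣ N⁻ G u ∩ N⁻ G v ∣           ≡⟨ cong (λ s → n ∸ ∣ s ∣) (cong₂ _∩_ (N⁻≡∁N⁺ u) (N⁻≡∁N⁺ v)) ⟩
    n ∸ ∣ ∁ (N⁺ G u) ∩ ∁ (N⁺ G v) ∣   ≡⟨ cong (λ s → n ∸ ∣ s ∣) (deMorgan₂ (N⁺ G u) (N⁺ G v)) ⟨
    n ∸ ∣ ∁ (N⁺ G u ∪ N⁺ G v) ∣       ≡⟨ cong (n ∸_) (∣∁p∣≡n∸∣p∣ (N⁺ G u ∪ N⁺ G v)) ⟩
    n ∸ (n ∸ ∣ N⁺ G u ∪ N⁺ G v ∣)     ≡⟨ m∸[m∸n]≡n (∣p∣≤n (N⁺ G u ∪ N⁺ G v)) ⟩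
    ∣ N⁺ G u ∪ N⁺ G v ∣               ≡⟨ ∣zipWith-tabulate∣≡count _∨_ (label G u) (label G v) ⟩
    ∣∪∣ u v                           ∎
    where open ≡-Reasoning

  instance
    ∣∪∣-nonZero : ∀ {u v} → NonZero (∣∪∣ u v)
    ∣∪∣-nonZero {u} {v} = subst NonZero (denom≡∣∪∣ u v) (denom-nonZero G u v)

  d≡∣△∣/∣∪∣ : ∀ u v → d G u v ≡ (+ ∣△∣ u v) / ∣∪∣ u v
  d≡∣△∣/∣∪∣ u v = begin
    d G u v
      ≡⟨ cong (1ℚ -_) (/-cong {{denom-nonZero G u v}} ∣∩∣≡count (denom≡∣∪∣ u v)) ⟩
    1ℚ - (+ count (λ i → label G u i ∧ label G v i)) / ∣∪∣ u v
      ≡⟨ 1-m/n≡k/n _ (∣△∣ u v) (count-∧+count-xor≡count-∨ (label G u) (label G v)) ⟩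
    (+ ∣△∣ u v) / ∣∪∣ u v
      ∎
    where
    open ≡-Reasoning
    ∣∩∣≡count : + ∣ N⁺ G u ∩ N⁺ G v ∣ ≡ + count (λ i → label G u i ∧ label G v i)
    ∣∩∣≡count = cong +_ (∣zipWith-tabulate∣≡count _∧_ (label G u) (label G v))

  d-triangle : ∀ u v w → d G u w ≤ d G u v + d G v w
  d-triangle u v w = begin
    d G u w                                           ≡⟨ d≡∣△∣/∣∪∣ u w ⟩
    (+ ∣△∣ u w) / ∣∪∣ u w                             ≤⟨ jaccard-triangle {D₂ = ∣△∣ u v} {D₃ = ∣△∣ v w}
                                                           (count-xor≤count-∨ a c) (count-xor-triangle a b c)
                                                           (count-∨ˡ-cover a b c) (count-∨ʳ-cover a b c) ⟩
    (+ ∣△∣ u v) / ∣∪∣ u v + (+ ∣△∣ v w) / ∣∪∣ v w     ≡⟨ cong₂ _+_ (d≡∣△∣/∣∪∣ u v) (d≡∣△∣/∣∪∣ v w) ⟨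
    d G u v + d G v w                                 ∎
    where
    open ≤-Reasoning
    a b c : Fin n → Bool
    a = label G u
    b = label G v
    c = label G w

lemma2 : ∀ {n : ℕ} (G : SignedCompleteGraph n) (u v w : Fin n) →
    d G u w ≤ d G u v + d G v w
lemma2 = d-triangle
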